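{- Proofs in $\mathcal{H}\omega$ whose endpiece is in normal form are closed under the axioms and rules of $\mathcal{H}\omega$: every axiom instance has such a proof, every conclusion of an $\omega$-rule inference has such a proof, and if both premises of a Leibniz rule inference have such proofs then so does its conclusion.
   Context: $\mathcal{H}\omega$ proves equations $M=_\omega N$ between closed $\lambda$-terms from: Identity axioms $M=_\omega M$; weak conversion axioms $(\lambda x.U)N =_\omega [N/x]U$ and $[N/x]U=_\omega(\lambda x.U)N$ (closed $(\lambda x.U)N$), $M=_\omega\mathbf{\Omega}$ and $\mathbf{\Omega}=_\omega M$ (closed unsolvable $M$, where $\mathbf{\Omega}\equiv(\lambda x.xx)(\lambda x.xx)$); the Leibniz rule (from $[M/z]X=_\omega[M/z]Y$ and $M=_\omega N$, $X,Y$ with at most $z$ free, infer $[N/z]X=_\omega[N/z]Y$); and the $\omega$-rule (from $PM=_\omega QM$ for all closed $M$ infer $P=_\omega Q$). Proofs are well-founded, possibly infinitely branching trees; the endpiece of a proof is the finite tree of Leibniz inferences consisting of the nodes whose path to the root passes through no premise of an $\omega$-rule inference. $\sim_{w\beta\Omega}$ is the least congruence containing the weak conversion axioms. An endpiece is in normal form if it establishes $M=_\omega N$ through a chain $M\sim_{w\beta\Omega}M_1P_1$, $P_1=_\omega Q_1$, $M_1Q_1\sim_{w\beta\Omega}M_2P_2,\dots,P_t=_\omega Q_t$, $M_tQ_t\sim_{w\beta\Omega}N$, each $P_i=_\omega Q_i$ being the direct conclusion of an $\omega$-rule inference; for $t=0$ it is an Identity axiom or $M=_\omega N$ obtained from $M=_\omega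 M$ and $M\sim_{w\beta\Omega}N$. -}

module Defs where

open import Data.Nat using (ℕ; zero; suc)
open import Data.Fin using (Fin; zero; suc)
open import Data.List using (List; []; _∷_)
open import Data.Product using (Σ)
open import Relation.Nullary using (¬_)

-- λ-terms, well-scoped de Bruijn representation.
-- Term n = terms with free variables among n; closed terms = Term 0.

data Term (n : ℕ) : Set where
  var : Fin n → Term n
  lam : Term (suc n) → Term n
  app : Term n → Term n → Term n

ext : ∀ {m n} → (Fin m → Fin n) → Fin (suc m) → Fin (suc n)
ext ρ zero    = zero
ext ρ (suc i) = suc (ρ i)

rename : ∀ {m n} → (Fin m → Fin n) → Term m → Term n
rename ρ (var i)   = var (ρ i)
rename ρ (lam t)   = lam (rename (ext ρ) t)
rename ρ (app t u) = app (rename ρ t) (rename ρ u)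

exts : ∀ {m n} → (Fin m → Term n) → Fin (suc m) → Term (suc n)
exts σ zero    = var zero
exts σ (suc i) = rename suc (σ i)

sub : ∀ {m n} → (Fin m → Term n) → Term m → Term n
sub σ (var i)   = σ i
sub σ (lam t)   = lam (sub (exts σ) t)
sub σ (app t u) = app (sub σ t) (sub σ u)

sub1 : ∀ {n} → Term n → Fin (suc n) → Term n
sub1 N zero    = N
sub1 N (suc i) = var i

-- U [ N ]  is  [N/x]U  where x is the outermost bound variable (index 0)
_[_] : ∀ {n} → Term (suc n) → Term n → Term n
U [ N ] = sub (sub1 N) U

weaken : ∀ {n} → Term 0 → Term n
weaken = rename (λ ())

I : Term 0
I = lam (var zero)

ω : Term 0
ω = lam (app (var zero) (var zero))

Ω : Term 0
Ω = app ω ω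

apps : ∀ {n} → Term n → List (Term n) → Term n
apps M []       = M
apps M (N ∷ Ns) = apps (app M N) Ns

data _→β_ {n : ℕ} : Term n → Term n → Set where
  β    : ∀ {U N} → app (lam U) N →β (U [ N ])
  appL : ∀ {M M' N} → M →β M' → app M N →β app M' N
  appR : ∀ {M N N'} → N →β N' → app M N →β app M N'
  ξ    : ∀ {M M'} → M →β M' → lam M →β lam M'

data _=β_ {n : ℕ} : Term n → Term n → Set where
  β-step  : ∀ {M N} → M →β N → M =β N
  β-refl  : ∀ {M} → M =β M
  β-sym   : ∀ {M N} → M =β N → N =β M
  β-trans : ∀ {M N P} → M =β N → N =β P → M =β P

Solvable : Term 0 → Set
Solvable M = Σ (List (Term 0)) (λ Ns → apps M Ns =β I)

Unsolvable : Term 0 → Set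
Unsolvable M = ¬ Solvable M

data WeakAx : Term 0 → Term 0 → Set where
  wβ  : ∀ (U : Term 1) (N : Term 0) → WeakAx (app (lam U) N) (U [ N ])
  wβ⁻ : ∀ (U : Term 1) (N : Term 0) → WeakAx (U [ N ]) (app (lam U) N)
  wΩ  : ∀ (M : Term 0) → Unsolvable M → WeakAx M Ω
  wΩ⁻ : ∀ (M : Term 0) → Unsolvable M → WeakAx Ω M

-- ∼wβΩ : least congruence (on terms, compatible with application and
-- abstraction, reflexive, symmetric, transitive) containing the weak
-- conversion axioms (which are instances on closed subterms).
data _∼wβΩ_ {n : ℕ} : Term n → Term n → Set where
  ax     : ∀ {A B} → WeakAx A B → weaken A ∼wβΩ weaken B
  ∼refl  : ∀ {M} → M ∼wβΩ M
  ∼sym   : ∀ {M N} → M ∼wβΩ N → N ∼wβΩ M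
  ∼trans : ∀ {M N P} → M ∼wβΩ N → N ∼wβΩ P → M ∼wβΩ P
  ∼app   : ∀ {M M' N N'} → M ∼wβΩ M' → N ∼wβΩ N' → app M N ∼wβΩ app M' N'
  ∼lam   : ∀ {M M'} → M ∼wβΩ M' → lam M ∼wβΩ lam M'

-- Proofs in Hω : well-founded, possibly infinitely branching trees.
-- Hω M N = type of proofs of M =ω N (M, N closed).

data Hω : Term 0 → Term 0 → Set where
  identity : ∀ (M : Term 0) → Hω M M
  βax      : ∀ (U : Term 1) (N : Term 0) → Hω (app (lam U) N) (U [ N ])
  βax⁻     : ∀ (U : Term 1) (N : Term 0) → Hω (U [ N ]) (app (lam U) N)
  Ωax      : ∀ (M : Term 0) → Unsolvable M → Hω M Ω
  Ωax⁻     : ∀ (M : Term 0) → Unsolvable M → Hω Ω M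
  -- Leibniz: X, Y have at most z free (z = index 0 of Term 1)
  leibniz  : ∀ (X Y : Term 1) (M N : Term 0) →
             Hω (X [ M ]) (Y [ M ]) → Hω M N → Hω (X [ N ]) (Y [ N ])
  ω-rule   : ∀ (P Q : Term 0) →
             ((M : Term 0) → Hω (app P M) (app Q M)) → Hω P Q

-- Proofs whose endpiece is in normal form.
-- Such a proof establishes M =ω N through a chain
--   M ∼ M₁P₁ , P₁ =ω Q₁ , M₁Q₁ ∼ M₂P₂ , … , P_t =ω Q_t , M_tQ_t ∼ N
-- where each P_i =ω Q_i is the direct conclusion of an ω-rule inference
-- (recorded here together with the proofs of its premises P_i R =ω Q_i R).
-- For t = 0 it is M =ω M together with M ∼wβΩ N (identity: N ≡ M via ∼refl).

data NFProof : Term 0 → Term 0 → Set where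
  chain-end  : ∀ {M N} → M ∼wβΩ N → NFProof M N
  chain-step : ∀ {M N} (M₁ P Q : Term 0) →
               M ∼wβΩ app M₁ P →
               ((R : Term 0) → Hω (app P R) (app Q R)) →
               NFProof (app M₁ Q) N →
               NFProof M N

-- A normal-form proof is a chain of ∼wβΩ-steps and ω-rule conclusions. Such
-- chains contain the axioms (chains without ω-steps) and ω-rule conclusions
-- (P ∼ I P and I Q ∼ Q around the single ω-step), and they can be
-- concatenated, reversed (the premises of an ω-rule are symmetric since Hω
-- proves symmetry by Leibniz) and placed in a context X: an ω-step
-- M₁ P ⇝ M₁ Q inside X becomes the ω-step C P ⇝ C Q for C = λz. X[M₁ z],
-- glued to the rest by β-conversions. A Leibniz inference from X[M] = Y[M]
-- and M = N is then the chain X[N] = X[M] = Y[M] = Y[N].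
module Submission where

open import Defs
open import Data.Product using (_×_; _,_)
open import Data.Nat using () renaming (suc to 1+)
open import Data.Fin using (Fin; zero; suc)
open import Function using (_∘_)
open import Relation.Binary.PropositionalEquality
  using (_≡_; refl; sym; trans; cong; cong₂; subst; subst₂)

ext-cong : ∀ {m n} {ρ ρ' : Fin m → Fin n} → (∀ i → ρ i ≡ ρ' i) → ∀ i → ext ρ i ≡ ext ρ' i
ext-cong h zero    = refl
ext-cong h (suc i) = cong suc (h i)

rename-cong : ∀ {m n} {ρ ρ' : Fin m → Fin n} → (∀ i → ρ i ≡ ρ' i) →
              (t : Term m) → rename ρ t ≡ rename ρ' t
rename-cong h (var i)   = cong var (h i)
rename-cong h (lam t)   = cong lam (rename-cong (ext-cong h) t)
rename-cong h (app t u) = cong₂ app (rename-cong h t) (rename-cong h u)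

rename-id : ∀ {m} {ρ : Fin m → Fin m} → (∀ i → ρ i ≡ i) → (t : Term m) → rename ρ t ≡ t
rename-id h (var i)   = cong var (h i)
rename-id h (lam t)   = cong lam (rename-id (ext-id h) t)
  where
  ext-id : ∀ {m} {ρ : Fin m → Fin m} → (∀ i → ρ i ≡ i) → ∀ i → ext ρ i ≡ i
  ext-id h zero    = refl
  ext-id h (suc i) = cong suc (h i)
rename-id h (app t u) = cong₂ app (rename-id h t) (rename-id h u)

rename-∘ : ∀ {l m n} (ρ : Fin m → Fin n) (ρ' : Fin l → Fin m) (t : Term l) →
           rename ρ (rename ρ' t) ≡ rename (ρ ∘ ρ') t
rename-∘ ρ ρ' (var i)   = refl
rename-∘ ρ ρ' (lam t)   = cong lam (trans (rename-∘ (ext ρ) (ext ρ') t) (rename-cong ext-∘ t))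
  where
  ext-∘ : ∀ i → ext ρ (ext ρ' i) ≡ ext (ρ ∘ ρ') i
  ext-∘ zero    = refl
  ext-∘ (suc i) = refl
rename-∘ ρ ρ' (app t u) = cong₂ app (rename-∘ ρ ρ' t) (rename-∘ ρ ρ' u)

exts-cong : ∀ {m n} {σ τ : Fin m → Term n} → (∀ i → σ i ≡ τ i) → ∀ i → exts σ i ≡ exts τ i
exts-cong h zero    = refl
exts-cong h (suc i) = cong (rename suc) (h i)

sub-cong : ∀ {m n} {σ τ : Fin m → Term n} → (∀ i → σ i ≡ τ i) →
           (t : Term m) → sub σ t ≡ sub τ t
sub-cong h (var i)   = h i
sub-cong h (lam t)   = cong lam (sub-cong (exts-cong h) t)
sub-cong h (app t u) = cong₂ app (sub-cong h t) (sub-cong h u)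

rename-as-sub : ∀ {m n} (ρ : Fin m → Fin n) (t : Term m) → rename ρ t ≡ sub (var ∘ ρ) t
rename-as-sub ρ (var i)   = refl
rename-as-sub ρ (lam t)   = cong lam (trans (rename-as-sub (ext ρ) t) (sub-cong var-ext t))
  where
  var-ext : ∀ i → var (ext ρ i) ≡ exts (var ∘ ρ) i
  var-ext zero    = refl
  var-ext (suc i) = refl
rename-as-sub ρ (app t u) = cong₂ app (rename-as-sub ρ t) (rename-as-sub ρ u)

sub-rename : ∀ {l m n} (σ : Fin m → Term n) (ρ : Fin l → Fin m) (t : Term l) →
             sub σ (rename ρ t) ≡ sub (σ ∘ ρ) t
sub-rename σ ρ (var i)   = refl
sub-rename σ ρ (lam t)   = cong lam (trans (sub-rename (exts σ) (ext ρ) t) (sub-cong exts-ext t))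
  where
  exts-ext : ∀ i → exts σ (ext ρ i) ≡ exts (σ ∘ ρ) i
  exts-ext zero    = refl
  exts-ext (suc i) = refl
sub-rename σ ρ (app t u) = cong₂ app (sub-rename σ ρ t) (sub-rename σ ρ u)

rename-sub : ∀ {l m n} (ρ : Fin m → Fin n) (σ : Fin l → Term m) (t : Term l) →
             rename ρ (sub σ t) ≡ sub (rename ρ ∘ σ) t
rename-sub ρ σ (var i)   = refl
rename-sub ρ σ (lam t)   = cong lam (trans (rename-sub (ext ρ) (exts σ) t) (sub-cong ext-exts t))
  where
  ext-exts : ∀ i → rename (ext ρ) (exts σ i) ≡ exts (rename ρ ∘ σ) i
  ext-exts zero    = refl
  ext-exts (suc i) = trans (rename-∘ (ext ρ) suc (σ i)) (sym (rename-∘ suc ρ (σ i)))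
rename-sub ρ σ (app t u) = cong₂ app (rename-sub ρ σ t) (rename-sub ρ σ u)

sub-∘ : ∀ {l m n} (τ : Fin m → Term n) (σ : Fin l → Term m) (t : Term l) →
        sub τ (sub σ t) ≡ sub (sub τ ∘ σ) t
sub-∘ τ σ (var i)   = refl
sub-∘ τ σ (lam t)   = cong lam (trans (sub-∘ (exts τ) (exts σ) t) (sub-cong exts-exts t))
  where
  exts-exts : ∀ i → sub (exts τ) (exts σ i) ≡ exts (sub τ ∘ σ) i
  exts-exts zero    = refl
  exts-exts (suc i) = trans (sub-rename (exts τ) suc (σ i)) (sym (rename-sub suc τ (σ i)))
sub-∘ τ σ (app t u) = cong₂ app (sub-∘ τ σ t) (sub-∘ τ σ u)

weaken-id : (A : Term 0) → weaken A ≡ A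
weaken-id = rename-id (λ ())

rename-weaken : ∀ {m n} (ρ : Fin m → Fin n) (A : Term 0) → rename ρ (weaken A) ≡ weaken A
rename-weaken ρ A = trans (rename-∘ ρ (λ ()) A) (rename-cong (λ ()) A)

sub-weaken : ∀ {m n} (σ : Fin m → Term n) (A : Term 0) → sub σ (weaken A) ≡ weaken A
sub-weaken σ A =
  trans (sub-rename σ (λ ()) A) (trans (sub-cong (λ ()) A) (sym (rename-as-sub (λ ()) A)))

weaken-[] : ∀ {n} (A : Term 0) (N : Term n) → weaken A [ N ] ≡ weaken A
weaken-[] A N = sub-weaken (sub1 N) A

∼-weakAx : ∀ {A B} → WeakAx A B → A ∼wβΩ B
∼-weakAx {A} {B} w = subst₂ _∼wβΩ_ (weaken-id A) (weaken-id B) (ax w)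

∼-rename : ∀ {m n} (ρ : Fin m → Fin n) {A B : Term m} → A ∼wβΩ B → rename ρ A ∼wβΩ rename ρ B
∼-rename ρ (ax {A} {B} w) = subst₂ _∼wβΩ_ (sym (rename-weaken ρ A)) (sym (rename-weaken ρ B)) (ax w)
∼-rename ρ ∼refl          = ∼refl
∼-rename ρ (∼sym e)       = ∼sym (∼-rename ρ e)
∼-rename ρ (∼trans e f)   = ∼trans (∼-rename ρ e) (∼-rename ρ f)
∼-rename ρ (∼app e f)     = ∼app (∼-rename ρ e) (∼-rename ρ f)
∼-rename ρ (∼lam e)       = ∼lam (∼-rename (ext ρ) e)

∼-sub-cong : ∀ {m n} {σ τ : Fin m → Term n} → (∀ i → σ i ∼wβΩ τ i) →
             (t : Term m) → sub σ t ∼wβΩ sub τ t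
∼-sub-cong h (var i)   = h i
∼-sub-cong h (lam t)   = ∼lam (∼-sub-cong (∼-exts h) t)
  where
  ∼-exts : ∀ {m n} {σ τ : Fin m → Term n} → (∀ i → σ i ∼wβΩ τ i) →
           ∀ i → exts σ i ∼wβΩ exts τ i
  ∼-exts h zero    = ∼refl
  ∼-exts h (suc i) = ∼-rename suc (h i)
∼-sub-cong h (app t u) = ∼app (∼-sub-cong h t) (∼-sub-cong h u)

∼-[]-cong : ∀ {n} (X : Term (1+ n)) {A B : Term n} → A ∼wβΩ B → (X [ A ]) ∼wβΩ (X [ B ])
∼-[]-cong X e = ∼-sub-cong (λ { zero → e ; (suc i) → ∼refl }) X

-- Leibniz with X = z and Y = A turns A = A into B = A.
Hω-sym : ∀ {A B} → Hω A B → Hω B A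
Hω-sym {A} {B} p =
  subst (Hω B) (A-closed B) (leibniz (var zero) (weaken A) A B A=A p)
  where
  A-closed : ∀ C → weaken A [ C ] ≡ A
  A-closed C = trans (weaken-[] A C) (weaken-id A)

  A=A : Hω A (weaken A [ A ])
  A=A = subst (Hω A) (sym (A-closed A)) (identity A)

nf-refl : ∀ M → NFProof M M
nf-refl M = chain-end ∼refl

nf-weakAx : ∀ {A B} → WeakAx A B → NFProof A B
nf-weakAx w = chain-end (∼-weakAx w)

nf-ω-rule : ∀ P Q → (∀ R → Hω (app P R) (app Q R)) → NFProof P Q
nf-ω-rule P Q h =
  chain-step I P Q (∼sym (∼-weakAx (wβ (var zero) P))) h (nf-weakAx (wβ (var zero) Q))

nf-∼-trans : ∀ {M M' N} → M ∼wβΩ M' → NFProof M' N → NFProof M N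
nf-∼-trans e (chain-end f)             = chain-end (∼trans e f)
nf-∼-trans e (chain-step M₁ P Q f h r) = chain-step M₁ P Q (∼trans e f) h r

nf-trans : ∀ {M N K} → NFProof M N → NFProof N K → NFProof M K
nf-trans (chain-end e)             q = nf-∼-trans e q
nf-trans (chain-step M₁ P Q f h r) q = chain-step M₁ P Q f h (nf-trans r q)

nf-sym : ∀ {M N} → NFProof M N → NFProof N M
nf-sym (chain-end e)             = chain-end (∼sym e)
nf-sym (chain-step M₁ P Q f h r) =
  nf-trans (nf-sym r) (chain-step M₁ Q P ∼refl (Hω-sym ∘ h) (chain-end (∼sym f)))

-- plugApp X M₁ is the body of the context λz. X[M₁ z].
applyTo : Term 0 → Fin 1 → Term 1
applyTo M₁ zero = app (weaken M₁) (var zero)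

plugApp : Term 1 → Term 0 → Term 1
plugApp X M₁ = sub (applyTo M₁) X

plugApp-[] : (X : Term 1) (M₁ R : Term 0) → plugApp X M₁ [ R ] ≡ X [ app M₁ R ]
plugApp-[] X M₁ R = trans (sub-∘ (sub1 R) (applyTo M₁) X) (sub-cong applyTo-[] X)
  where
  applyTo-[] : ∀ i → applyTo M₁ i [ R ] ≡ sub1 (app M₁ R) i
  applyTo-[] zero = cong (λ M → app M R) (trans (weaken-[] M₁ R) (weaken-id M₁))

nf-[]-cong : (X : Term 1) {M N : Term 0} → NFProof M N → NFProof (X [ M ]) (X [ N ])
nf-[]-cong X (chain-end e)             = chain-end (∼-[]-cong X e)
nf-[]-cong X (chain-step M₁ P Q f h r) =
  chain-step (lam C) P Q
    (∼trans (∼-[]-cong X f) (∼sym (β-plugApp P)))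
    h
    (nf-∼-trans (β-plugApp Q) (nf-[]-cong X r))
  where
  C : Term 1
  C = plugApp X M₁

  β-plugApp : ∀ R → app (lam C) R ∼wβΩ (X [ app M₁ R ])
  β-plugApp R = subst (app (lam C) R ∼wβΩ_) (plugApp-[] X M₁ R) (∼-weakAx (wβ C R))

nf-leibniz : ∀ X Y M N → NFProof (X [ M ]) (Y [ M ]) → NFProof M N →
             NFProof (X [ N ]) (Y [ N ])
nf-leibniz X Y M N p q = nf-trans (nf-sym (nf-[]-cong X q)) (nf-trans p (nf-[]-cong Y q))

lemma5p5 :
      ((M : Term 0) → NFProof M M)
    × ((U : Term 1) (N : Term 0) → NFProof (app (lam U) N) (U [ N ]))
    × ((U : Term 1) (N : Term 0) → NFProof (U [ N ]) (app (lam U) N))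
    × ((M : Term 0) → Unsolvable M → NFProof M Ω)
    × ((M : Term 0) → Unsolvable M → NFProof Ω M)
    × ((P Q : Term 0) → ((M : Term 0) → Hω (app P M) (app Q M)) → NFProof P Q)
    × ((X Y : Term 1) (M N : Term 0) →
         NFProof (X [ M ]) (Y [ M ]) → NFProof M N → NFProof (X [ N ]) (Y [ N ]))
lemma5p5 =
    nf-refl
  , (λ U N → nf-weakAx (wβ U N))
  , (λ U N → nf-weakAx (wβ⁻ U N))
  , (λ M u → nf-weakAx (wΩ M u))
  , (λ M u → nf-weakAx (wΩ⁻ M u))
  , nf-ω-rule
  , nf-leibniz
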